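{- Let $T\subseteq\mathbb{Z}^n$ be an integer tiling with $\Upsilon_n$ such that $\mathbf{0}\in T$, and let $\mathcal{D}_3$ be the set of points of $\{0,1,2\}^n$ in which the symbol $2$ appears exactly three times. If $X=3e_r+2e_s\in T$ (with $r\ne s$), then for every $k\notin\{r,s\}$ there exists a unique $j\notin\{r,s,k\}$ for which there is a codeword $Y=(y_1,\dots,y_n)\in\mathcal{D}_3\cap T$ with $y_r=1$ and $y_s=y_k=y_j=2$.
   Context: $e_r$ is the $r$-th unit vector. $\Upsilon_n=\{U\in\mathbb{Z}^n:\sum_i|x_i-u_i|\le1\text{ for some }X\in\{ -1,0\}^n\}$. A set $T\subseteq\mathbb{Z}^n$ is an integer tiling with $\Upsilon_n$ if the translates $X+\Upsilon_n$, $X\in T$, partition $\mathbb{Z}^n$; its elements are called codewords. -}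

module Defs where

open import Data.Nat using (ℕ; zero; suc)
import Data.Nat as ℕ
open import Data.Integer using (ℤ; +_; -[1+_]; _-_; ∣_∣)
import Data.Integer as ℤ
open import Data.Fin using (Fin; zero; suc)
open import Data.Product using (Σ; _×_; ∃)
open import Data.Sum using (_⊎_)
open import Relation.Binary.PropositionalEquality using (_≡_; _≢_)
open import Relation.Nullary using (yes; no)

Point : ℕ → Set
Point n = Fin n → ℤ

𝟎 : ∀ {n} → Point n
𝟎 _ = + 0

e : ∀ {n} → Fin n → Point n
e r i with r Data.Fin.≟ i
... | yes _ = + 1
... | no  _ = + 0

_⊕_ : ∀ {n} → Point n → Point n → Point n
(X ⊕ Y) i = X i ℤ.+ Y i

_⊖_ : ∀ {n} → Point n → Point n → Point n
(X ⊖ Y) i = X i - Y i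

_·_ : ∀ {n} → ℤ → Point n → Point n
(c · X) i = c ℤ.* X i

_≐_ : ∀ {n} → Point n → Point n → Set
X ≐ Y = ∀ i → X i ≡ Y i

dist₁ : ∀ {n} → Point n → Point n → ℕ
dist₁ {zero}  X U = 0
dist₁ {suc n} X U = ∣ X zero - U zero ∣ ℕ.+ dist₁ (λ i → X (suc i)) (λ i → U (suc i))

Υ : (n : ℕ) → Point n → Set
Υ n U = Σ (Point n) λ X → (∀ i → X i ≡ + 0 ⊎ X i ≡ -[1+ 0 ]) × (dist₁ X U ℕ.≤ 1)

-- T (a set of points, given as a predicate) is an integer tiling with Υ_n:
-- the translates X + Υ_n, X ∈ T, partition ℤ^n.
IsTiling : (n : ℕ) → (Point n → Set) → Set
IsTiling n T =
  (∀ Z → Σ (Point n) λ X → T X × Υ n (Z ⊖ X)) ×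
  (∀ Z X X' → T X → T X' → Υ n (Z ⊖ X) → Υ n (Z ⊖ X') → X ≐ X')

count2 : ∀ {n} → Point n → ℕ
count2 {zero}  Y = 0
count2 {suc n} Y with Y zero ℤ.≟ + 2
... | yes _ = suc (count2 (λ i → Y (suc i)))
... | no  _ = count2 (λ i → Y (suc i))

D₃ : (n : ℕ) → Point n → Set
D₃ n Y = (∀ i → Y i ≡ + 0 ⊎ Y i ≡ + 1 ⊎ Y i ≡ + 2) × count2 Y ≡ 3

module Submission where

-- Write ρ(u) for the distance of an integer u to the cube {-1, 0}; then
-- U ∈ Υ_n iff Σᵢ ρ(uᵢ) ≤ 1.  With excess(d) = max(0, |d| - 1), every point d with
-- Σᵢ excess(dᵢ) ≤ 2 is a difference of two points of Υ_n, so two codewords A, B of a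
-- tiling with Σᵢ excess(aᵢ - bᵢ) ≤ 2 coincide (close-codewords).
-- Let Z = e_r + e_s + e_k and let C be the codeword covering Z.  As Z - C ∈ Υ_n, C is 0/1
-- outside the frame (r, s, k), or outside (m, r, s, k) for one further coordinate m, and
-- its values on the frame lie in a finite list of candidates.  Comparing with the codewords
-- 0 and X = 3e_r + 2e_s excludes every candidate except (m, r, s, k) ↦ (2, 1, 2, 2) and
-- (r, s, k) ↦ (1, 2, 3); these finite tables are checked by evaluation.  The second
-- profile is excluded in the same way through the codeword covering e_r + e_k, now also
-- compared with C.  Hence C has the required shape with j = m, and every codeword Y of the
-- stated form also covers Z, so Y = C, which makes j unique.

open import Defs
open import Data.Nat using (ℕ; zero; suc; _+_; _≤_; _≤?_; z≤n; s≤s)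
import Data.Nat.Properties as ℕP
open import Data.Nat.ListAction using (sum)
open import Data.Integer using (ℤ; +_; -[1+_]; _-_; ∣_∣) renaming (_⊖_ to _⊖ℕ_)
import Data.Integer as ℤ
import Data.Integer.Properties as ℤP
open import Data.Integer.Tactic.RingSolver using (solve-∀)
open import Data.Bool using (if_then_else_)
open import Data.Empty using (⊥-elim)
open import Data.Fin using (Fin; zero; suc)
import Data.Fin.Properties as FinP
open import Data.Vec.Functional using () renaming (_∷_ to _◂_)
open import Data.List using (List; []; _∷_; map; zipWith; filter; cartesianProductWith; length)
import Data.List.Properties as ListP
open import Data.List.Membership.Propositional using (_∈_; _∉_)
open import Data.List.Membership.Propositional.Properties using (∈-map⁺; ∈-filter⁺; ∈-cartesianProductWith⁺)
import Data.List.Membership.DecPropositional as DecMembership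
open import Data.List.Relation.Unary.Any using (Any; here; there; any?)
open import Data.List.Relation.Unary.All as All using (All; []; _∷_)
open import Data.List.Relation.Unary.All.Properties using (¬Any⇒All¬)
open import Data.List.Relation.Unary.Unique.Propositional using (Unique; []; _∷_)
open import Data.List.Relation.Binary.Pointwise using (Pointwise; []; _∷_)
open import Data.Product using (Σ; _×_; _,_; Σ-syntax; proj₁; proj₂)
open import Data.Sum using (_⊎_; inj₁; inj₂)
open import Function using (_∘_)
open import Relation.Nullary using (Dec; does; yes; no; ¬_; ¬?)
open import Relation.Nullary.Decidable using (_×-dec_; _⊎-dec_; True; toWitness)
open import Relation.Unary using (Decidable)
open import Relation.Binary.PropositionalEquality
open import Algebra.Properties.Monoid.Sum ℕP.+-0-monoid using (sum-cong-≗) renaming (sum to ∑)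

_─_ : ∀ {n} → (Fin n → ℕ) → Fin n → (Fin n → ℕ)
(f ─ p) i = if does (i FinP.≟ p) then 0 else f i

─-other : ∀ {n} (f : Fin n → ℕ) {p i} → i ≢ p → (f ─ p) i ≡ f i
─-other f {p} {i} i≢p with i FinP.≟ p
... | yes i≡p = ⊥-elim (i≢p i≡p)
... | no _ = refl

∑-pick : ∀ {n} (f : Fin n → ℕ) p → ∑ f ≡ f p + ∑ (f ─ p)
∑-pick f zero = refl
∑-pick f (suc p) = begin
  f zero + ∑ (f ∘ suc)                ≡⟨ cong (_+_ (f zero)) (∑-pick (f ∘ suc) p) ⟩
  f zero + (f (suc p) + rest)         ≡⟨ ℕP.+-assoc (f zero) (f (suc p)) rest ⟨
  (f zero + f (suc p)) + rest         ≡⟨ cong (_+ rest) (ℕP.+-comm (f zero) (f (suc p))) ⟩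
  (f (suc p) + f zero) + rest         ≡⟨ ℕP.+-assoc (f (suc p)) (f zero) rest ⟩
  f (suc p) + ∑ (f ─ suc p)           ∎
  where open ≡-Reasoning
        rest = ∑ ((f ∘ suc) ─ p)

_∖_ : ∀ {n} → (Fin n → ℕ) → List (Fin n) → (Fin n → ℕ)
f ∖ [] = f
f ∖ (p ∷ F) = (f ─ p) ∖ F

∖-∉ : ∀ {n} (f : Fin n → ℕ) F {i} → i ∉ F → (f ∖ F) i ≡ f i
∖-∉ f [] _ = refl
∖-∉ f (p ∷ F) i∉ = trans (∖-∉ (f ─ p) F (i∉ ∘ there)) (─-other f (i∉ ∘ here))

∖-vanishes : ∀ {n} (f : Fin n → ℕ) F → (∀ i → i ∉ F → f i ≡ 0) → ∀ i → (f ∖ F) i ≡ 0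
∖-vanishes f [] off i = off i (λ ())
∖-vanishes f (p ∷ F) off = ∖-vanishes (f ─ p) F off′
  where
  off′ : ∀ i → i ∉ F → (f ─ p) i ≡ 0
  off′ i i∉F with i FinP.≟ p
  ... | yes _ = refl
  ... | no i≢p = off i λ { (here i≡p) → i≢p i≡p ; (there i∈F) → i∉F i∈F }

∑-split : ∀ {n} (f : Fin n → ℕ) {F} → Unique F → ∑ f ≡ sum (map f F) + ∑ (f ∖ F)
∑-split f [] = refl
∑-split f {p ∷ F} (p∉F ∷ uF) = begin
  ∑ f                                   ≡⟨ ∑-pick f p ⟩
  f p + ∑ (f ─ p)                       ≡⟨ cong (_+_ (f p)) (∑-split (f ─ p) uF) ⟩
  f p + (sum (map (f ─ p) F) + rest)    ≡⟨ cong (λ xs → f p + (sum xs + rest)) same ⟩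
  f p + (sum (map f F) + rest)          ≡⟨ ℕP.+-assoc (f p) (sum (map f F)) rest ⟨
  sum (map f (p ∷ F)) + rest            ∎
  where open ≡-Reasoning
        rest = ∑ (f ∖ (p ∷ F))
        same : map (f ─ p) F ≡ map f F
        same = ListP.map-cong-local (All.map (λ p≢i → ─-other f (p≢i ∘ sym)) p∉F)

∑-zero : ∀ {n} (f : Fin n → ℕ) → (∀ i → f i ≡ 0) → ∑ f ≡ 0
∑-zero {zero} f _ = refl
∑-zero {suc n} f z = cong₂ _+_ (z zero) (∑-zero (f ∘ suc) (z ∘ suc))

∑-frame : ∀ {n} (f : Fin n → ℕ) {F} → Unique F → (∀ i → i ∉ F → f i ≡ 0) → ∑ f ≡ sum (map f F)
∑-frame f {F} uF off = begin
  ∑ f                          ≡⟨ ∑-split f uF ⟩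
  sum (map f F) + ∑ (f ∖ F)    ≡⟨ cong (_+_ (sum (map f F))) (∑-zero (f ∖ F) (∖-vanishes f F off)) ⟩
  sum (map f F) + 0            ≡⟨ ℕP.+-identityʳ _ ⟩
  sum (map f F)                ∎
  where open ≡-Reasoning

frame-≤-∑ : ∀ {n} (f : Fin n → ℕ) {F} → Unique F → sum (map f F) ≤ ∑ f
frame-≤-∑ f {F} uF = subst (sum (map f F) ≤_) (sym (∑-split f uF)) (ℕP.m≤m+n _ _)

entry-≤-∑ : ∀ {n} (f : Fin n → ℕ) i → f i ≤ ∑ f
entry-≤-∑ f i = subst (_≤ ∑ f) (ℕP.+-identityʳ (f i)) (frame-≤-∑ f ([] ∷ []))

∑-mono : ∀ {n} (f g : Fin n → ℕ) → (∀ i → f i ≤ g i) → ∑ f ≤ ∑ g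
∑-mono {zero} f g _ = z≤n
∑-mono {suc n} f g le = ℕP.+-mono-≤ (le zero) (∑-mono (f ∘ suc) (g ∘ suc) (le ∘ suc))

∑≤1-shape : ∀ {n} (f : Fin n → ℕ) → ∑ f ≤ 1 →
  (∀ i → f i ≡ 0) ⊎ Σ[ m ∈ Fin n ] (∀ i → i ≢ m → f i ≡ 0)
∑≤1-shape {zero} f _ = inj₁ (λ ())
∑≤1-shape {suc n} f ∑≤1 with f zero in eq
... | zero with ∑≤1-shape (f ∘ suc) ∑≤1
...   | inj₁ z = inj₁ λ { zero → eq ; (suc i) → z i }
...   | inj₂ (m , z) = inj₂ (suc m , λ { zero _ → eq ; (suc i) i≢m → z i (i≢m ∘ cong suc) })
∑≤1-shape {suc n} f (s≤s ∑≤0) | suc _ =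
  inj₂ (zero , λ { zero 0≢0 → ⊥-elim (0≢0 refl)
                 ; (suc i) _ → ℕP.n≤0⇒n≡0 (ℕP.≤-trans (entry-≤-∑ (f ∘ suc) i) (ℕP.m+n≤o⇒n≤o _ ∑≤0)) })

offFrame-shape : ∀ {n} (f : Fin n → ℕ) {F} → Unique F → ∑ f ≤ 1 →
  (∀ i → i ∉ F → f i ≡ 0) ⊎ Σ[ m ∈ Fin n ] m ∉ F × (∀ i → i ∉ m ∷ F → f i ≡ 0)
offFrame-shape f {F} uF ∑≤1 with ∑≤1-shape (f ∖ F) rest≤1
  where rest≤1 = ℕP.≤-trans (subst (∑ (f ∖ F) ≤_) (sym (∑-split f uF)) (ℕP.m≤n+m _ _)) ∑≤1
... | inj₁ z = inj₁ λ i i∉F → trans (sym (∖-∉ f F i∉F)) (z i)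
... | inj₂ (m , z) with any? (m FinP.≟_) F
...   | yes m∈F = inj₁ λ i i∉F → trans (sym (∖-∉ f F i∉F)) (z i (λ { refl → i∉F m∈F }))
...   | no m∉F = inj₂ (m , m∉F , λ i i∉ → trans (sym (∖-∉ f F (i∉ ∘ there))) (z i (i∉ ∘ here)))

-- ρ u is the distance from u to {-1, 0}.
ρ : ℤ → ℕ
ρ (+ k) = k
ρ -[1+ k ] = k

Cube : ℤ → Set
Cube x = x ≡ + 0 ⊎ x ≡ -[1+ 0 ]

nearest : ℤ → ℤ
nearest (+ _) = + 0
nearest -[1+ _ ] = -[1+ 0 ]

nearest-cube : ∀ u → Cube (nearest u)
nearest-cube (+ _) = inj₁ refl
nearest-cube -[1+ _ ] = inj₂ refl

nearest-dist : ∀ u → ∣ nearest u - u ∣ ≡ ρ u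
nearest-dist (+ zero) = refl
nearest-dist (+ suc k) = refl
nearest-dist -[1+ k ] = refl

cube-dist : ∀ {x} u → Cube x → ρ u ≤ ∣ x - u ∣
cube-dist (+ zero) (inj₁ refl) = z≤n
cube-dist (+ suc k) (inj₁ refl) = ℕP.≤-refl
cube-dist -[1+ k ] (inj₁ refl) = ℕP.n≤1+n k
cube-dist (+ zero) (inj₂ refl) = z≤n
cube-dist (+ suc k) (inj₂ refl) = ℕP.n≤1+n (suc k)
cube-dist -[1+ k ] (inj₂ refl) = ℕP.≤-refl

dist₁-∑ : ∀ {n} (X U : Point n) → dist₁ X U ≡ ∑ (λ i → ∣ X i - U i ∣)
dist₁-∑ {zero} X U = refl
dist₁-∑ {suc n} X U = cong (_+_ ∣ X zero - U zero ∣) (dist₁-∑ (X ∘ suc) (U ∘ suc))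

Υ-intro : ∀ {n} (U : Point n) → ∑ (ρ ∘ U) ≤ 1 → Υ n U
Υ-intro U ∑≤1 = nearest ∘ U , nearest-cube ∘ U ,
  subst (_≤ 1) (sym (trans (dist₁-∑ (nearest ∘ U) U) (sum-cong-≗ (nearest-dist ∘ U)))) ∑≤1

Υ-elim : ∀ {n} (U : Point n) → Υ n U → ∑ (ρ ∘ U) ≤ 1
Υ-elim U (X , cube , d≤1) =
  ℕP.≤-trans (∑-mono (ρ ∘ U) _ (λ i → cube-dist (U i) (cube i))) (subst (_≤ 1) (dist₁-∑ X U) d≤1)

-- excess d = max(0, |d| - 1), the amount by which d leaves [-1, 1].
excess : ℤ → ℕ
excess (+ zero) = 0
excess (+ suc k) = k
excess -[1+ k ] = k

split-excess : ∀ x α β → excess x ≡ α + β → Σ[ y ∈ ℤ ] ρ y ≡ α × ρ (y - x) ≡ β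
split-excess (+ zero) zero zero refl = + 0 , refl , refl
split-excess (+ suc .(α + β)) α β refl = + α , refl , cong ρ (begin
  α ⊖ℕ suc (α + β)          ≡⟨ cong (α ⊖ℕ_) (sym (ℕP.+-suc α β)) ⟩
  α ⊖ℕ (α + suc β)          ≡⟨ cong (_⊖ℕ (α + suc β)) (sym (ℕP.+-identityʳ α)) ⟩
  (α + 0) ⊖ℕ (α + suc β)    ≡⟨ ℤP.+-cancelˡ-⊖ α 0 (suc β) ⟩
  -[1+ β ]                  ∎)
  where open ≡-Reasoning
split-excess -[1+ .(α + β) ] α β refl = -[1+ α ] , refl , cong ρ (begin
  suc (α + β) ⊖ℕ suc α      ≡⟨ ℤP.[1+m]⊖[1+n]≡m⊖n (α + β) α ⟩
  (α + β) ⊖ℕ α              ≡⟨ cong ((α + β) ⊖ℕ_) (sym (ℕP.+-identityʳ α)) ⟩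
  (α + β) ⊖ℕ (α + 0)        ≡⟨ ℤP.+-cancelˡ-⊖ α β 0 ⟩
  + β                       ∎)
  where open ≡-Reasoning

budget : ∀ e r a b → e + r ≤ a + b →
  Σ[ α ∈ ℕ ] Σ[ β ∈ ℕ ] Σ[ a′ ∈ ℕ ] Σ[ b′ ∈ ℕ ]
    e ≡ α + β × a ≡ α + a′ × b ≡ β + b′ × r ≤ a′ + b′
budget e r a b e+r≤a+b with e ≤? a
... | yes e≤a with ℕP.m≤n⇒∃[o]m+o≡n e≤a
...   | a′ , refl = e , 0 , a′ , b , sym (ℕP.+-identityʳ e) , refl , refl ,
          ℕP.+-cancelˡ-≤ e r (a′ + b) (subst (e + r ≤_) (ℕP.+-assoc e a′ b) e+r≤a+b)
budget e r a b e+r≤a+b | no e≰a with ℕP.m≤n⇒∃[o]m+o≡n (ℕP.<⇒≤ (ℕP.≰⇒> e≰a))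
... | β , refl with ℕP.m≤n⇒∃[o]m+o≡n (ℕP.m+n≤o⇒m≤o β β+r≤b)
  where β+r≤b = ℕP.+-cancelˡ-≤ a (β + r) b (subst (_≤ a + b) (ℕP.+-assoc a β r) e+r≤a+b)
...   | b′ , refl = a , β , 0 , b′ , refl , sym (ℕP.+-identityʳ a) , refl ,
          ℕP.+-cancelˡ-≤ β r b′ (ℕP.+-cancelˡ-≤ a (β + r) (β + b′)
            (subst (_≤ a + (β + b′)) (ℕP.+-assoc a β r) e+r≤a+b))

decompose : ∀ {n} (d : Point n) a b → ∑ (excess ∘ d) ≤ a + b →
  Σ[ s ∈ Point n ] ∑ (ρ ∘ s) ≤ a × ∑ (ρ ∘ (s ⊖ d)) ≤ b
decompose {zero} d a b _ = (λ ()) , z≤n , z≤n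
decompose {suc n} d a b e+r≤a+b with budget (excess (d zero)) (∑ (excess ∘ d ∘ suc)) a b e+r≤a+b
... | α , β , a′ , b′ , e≡α+β , refl , refl , r≤a′+b′
    with split-excess (d zero) α β e≡α+β | decompose (d ∘ suc) a′ b′ r≤a′+b′
...   | y , ρy≡α , ρ[y-x]≡β | s , ∑ρs≤a′ , ∑ρ[s-d]≤b′ =
  y ◂ s , ℕP.+-mono-≤ (ℕP.≤-reflexive ρy≡α) ∑ρs≤a′ , ℕP.+-mono-≤ (ℕP.≤-reflexive ρ[y-x]≡β) ∑ρ[s-d]≤b′

shift-left : ∀ a b s → (b ℤ.+ s) - a ≡ s - (a - b)
shift-left = solve-∀

shift-right : ∀ b s → (b ℤ.+ s) - b ≡ s
shift-right = solve-∀

-- Two codewords whose difference has total excess at most 2 have a common point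
-- B + s in their translates of Υ_n, hence coincide.
close-codewords : ∀ {n} {T : Point n → Set} → IsTiling n T → ∀ {A B} → T A → T B →
  ∑ (λ i → excess (A i - B i)) ≤ 2 → A ≐ B
close-codewords (_ , disjoint) {A} {B} TA TB close with decompose (A ⊖ B) 1 1 close
... | s , ∑ρs≤1 , ∑ρ[s-d]≤1 = disjoint (B ⊕ s) A B TA TB
  (Υ-intro _ (subst (_≤ 1) (sum-cong-≗ (λ i → cong ρ (sym (shift-left (A i) (B i) (s i))))) ∑ρ[s-d]≤1))
  (Υ-intro _ (subst (_≤ 1) (sum-cong-≗ (λ i → cong ρ (sym (shift-right (B i) (s i))))) ∑ρs≤1))

_⟨_⟩ : ∀ {n} → Point n → List (Fin n) → List ℤ
P ⟨ F ⟩ = map P F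

Binary : ∀ {n} → List (Fin n) → Point n → Set
Binary F P = ∀ i → i ∉ F → P i ≡ + 0 ⊎ P i ≡ + 1

binary-extend : ∀ {n} {m : Fin n} {F} {P : Point n} → Binary F P → Binary (m ∷ F) P
binary-extend bP i i∉ = bP i (i∉ ∘ there)

binary-shrink : ∀ {n} {m : Fin n} {F} {P : Point n} → Binary (m ∷ F) P →
  P m ≡ + 0 ⊎ P m ≡ + 1 → Binary F P
binary-shrink {m = m} bP Pm i i∉F with i FinP.≟ m
... | yes refl = Pm
... | no i≢m = bP i λ { (here i≡m) → i≢m i≡m ; (there i∈F) → i∉F i∈F }

frame-or-binary : ∀ {n} {G : List (Fin n)} (P : Point n) → Binary G P →
  ∀ i → P i ∈ P ⟨ G ⟩ ⊎ (P i ≡ + 0 ⊎ P i ≡ + 1)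
frame-or-binary {G = G} P bP i with any? (i FinP.≟_) G
... | yes i∈G = inj₁ (∈-map⁺ P i∈G)
... | no i∉G = inj₂ (bP i i∉G)

map-pair : ∀ {n} {A : Set} (g : ℤ → ℤ → A) (P Q : Point n) F →
  map (λ i → g (P i) (Q i)) F ≡ zipWith g (P ⟨ F ⟩) (Q ⟨ F ⟩)
map-pair g P Q [] = refl
map-pair g P Q (i ∷ F) = cong (g (P i) (Q i) ∷_) (map-pair g P Q F)

frameExcess : List ℤ → List ℤ → ℕ
frameExcess a b = sum (zipWith (λ x y → excess (x - y)) a b)

excess-binary : ∀ {x y} → x ≡ + 0 ⊎ x ≡ + 1 → y ≡ + 0 ⊎ y ≡ + 1 → excess (x - y) ≡ 0
excess-binary (inj₁ refl) (inj₁ refl) = refl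
excess-binary (inj₁ refl) (inj₂ refl) = refl
excess-binary (inj₂ refl) (inj₁ refl) = refl
excess-binary (inj₂ refl) (inj₂ refl) = refl

frame-excess : ∀ {n} {F : List (Fin n)} {A B} → Unique F → Binary F A → Binary F B →
  ∑ (λ i → excess (A i - B i)) ≡ frameExcess (A ⟨ F ⟩) (B ⟨ F ⟩)
frame-excess {F = F} {A} {B} uF bA bB =
  trans (∑-frame _ uF (λ i i∉F → excess-binary (bA i i∉F) (bB i i∉F)))
        (cong sum (map-pair (λ x y → excess (x - y)) A B F))

Clash : List ℤ → List ℤ → Set
Clash a b = frameExcess a b ≤ 2 × a ≢ b

clash? : ∀ a b → Dec (Clash a b)
clash? a b = (frameExcess a b ≤? 2) ×-dec ¬? (ListP.≡-dec ℤ._≟_ a b)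

no-clash : ∀ {n} {T : Point n → Set} {F : List (Fin n)} {A B} → IsTiling n T → Unique F →
  T A → T B → Binary F A → Binary F B → ¬ Clash (A ⟨ F ⟩) (B ⟨ F ⟩)
no-clash {F = F} til uF TA TB bA bB (close , a≢b) =
  a≢b (ListP.map-cong (close-codewords til TA TB (subst (_≤ 2) (sym (frame-excess uF bA bB)) close)) F)

offsets : List ℤ
offsets = + 0 ∷ -[1+ 0 ] ∷ + 1 ∷ -[1+ 1 ] ∷ []

ρ≤1-offsets : ∀ u → ρ u ≤ 1 → u ∈ offsets
ρ≤1-offsets (+ 0) _ = here refl
ρ≤1-offsets (+ 1) _ = there (there (here refl))
ρ≤1-offsets -[1+ 0 ] _ = there (here refl)
ρ≤1-offsets -[1+ 1 ] _ = there (there (there (here refl)))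
ρ≤1-offsets (+ suc (suc _)) (s≤s ())
ρ≤1-offsets -[1+ suc (suc _) ] (s≤s ())

-- Possible values at a coordinate where the covered point has value z.
window : ℤ → List ℤ
window z = map (z -_) offsets

choices : {A : Set} → List (List A) → List (List A)
choices [] = [] ∷ []
choices (xs ∷ xss) = cartesianProductWith _∷_ xs (choices xss)

∈-choices : ∀ {A : Set} {cs : List A} {Ss} → Pointwise _∈_ cs Ss → cs ∈ choices Ss
∈-choices [] = here refl
∈-choices (c∈S ∷ cs∈Ss) = ∈-cartesianProductWith⁺ _∷_ c∈S (∈-choices cs∈Ss)

pointwise-map : ∀ {A B : Set} {R : A → B → Set} {n} (f : Fin n → A) (g : Fin n → B) →
  (∀ i → R (f i) (g i)) → ∀ F → Pointwise R (map f F) (map g F)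
pointwise-map f g r [] = []
pointwise-map f g r (i ∷ F) = r i ∷ pointwise-map f g r F

frameRho : List ℤ → List ℤ → ℕ
frameRho zs cs = sum (zipWith (λ z c → ρ (z - c)) zs cs)

candidates : List ℤ → List (List ℤ)
candidates zs = filter (λ cs → frameRho zs cs ≤? 1) (choices (map window zs))

sub-sub : ∀ z c → z - (z - c) ≡ c
sub-sub = solve-∀

profile-candidate : ∀ {n} {F : List (Fin n)} (Z C : Point n) → Unique F →
  ∑ (ρ ∘ (Z ⊖ C)) ≤ 1 → C ⟨ F ⟩ ∈ candidates (Z ⟨ F ⟩)
profile-candidate {F = F} Z C uF ∑≤1 =
  ∈-filter⁺ (λ cs → frameRho (Z ⟨ F ⟩) cs ≤? 1)
    (∈-choices (subst (Pointwise _∈_ (C ⟨ F ⟩)) (ListP.map-∘ F) (pointwise-map C (window ∘ Z) in-window F)))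
    (subst (_≤ 1) (cong sum (map-pair (λ z c → ρ (z - c)) Z C F)) (ℕP.≤-trans (frame-≤-∑ _ uF) ∑≤1))
  where
  in-window : ∀ i → C i ∈ window (Z i)
  in-window i = subst (_∈ window (Z i)) (sub-sub (Z i) (C i))
    (∈-map⁺ (Z i -_) (ρ≤1-offsets (Z i - C i) (ℕP.≤-trans (entry-≤-∑ (ρ ∘ (Z ⊖ C)) i) ∑≤1)))

over-binary : ∀ {z c} → z ≡ + 0 → ρ (z - c) ≡ 0 → c ≡ + 0 ⊎ c ≡ + 1
over-binary {c = + 0} refl _ = inj₁ refl
over-binary {c = + 1} refl _ = inj₂ refl
over-binary {c = + suc (suc k)} refl ()
over-binary {c = -[1+ k ]} refl ()

binary-ρ : ∀ {z c} → z ≡ + 0 → c ≡ + 0 ⊎ c ≡ + 1 → ρ (z - c) ≡ 0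
binary-ρ refl (inj₁ refl) = refl
binary-ρ refl (inj₂ refl) = refl

over-shape : ∀ {n} {F : List (Fin n)} (Z C : Point n) → Unique F → (∀ i → i ∉ F → Z i ≡ + 0) →
  ∑ (ρ ∘ (Z ⊖ C)) ≤ 1 → Binary F C ⊎ Σ[ m ∈ Fin n ] m ∉ F × Binary (m ∷ F) C
over-shape Z C uF Z-off ∑≤1 with offFrame-shape (ρ ∘ (Z ⊖ C)) uF ∑≤1
... | inj₁ off = inj₁ λ i i∉F → over-binary (Z-off i i∉F) (off i i∉F)
... | inj₂ (m , m∉F , off) = inj₂ (m , m∉F , λ i i∉ → over-binary (Z-off i (i∉ ∘ there)) (off i i∉))

over-from-profile : ∀ {n} {G : List (Fin n)} (Z Y : Point n) → Unique G → (∀ i → i ∉ G → Z i ≡ + 0) →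
  Binary G Y → frameRho (Z ⟨ G ⟩) (Y ⟨ G ⟩) ≤ 1 → Υ n (Z ⊖ Y)
over-from-profile {G = G} Z Y uG Z-off bY frame≤1 = Υ-intro (Z ⊖ Y) (subst (_≤ 1) (sym ∑≡frame) frame≤1)
  where
  ∑≡frame : ∑ (ρ ∘ (Z ⊖ Y)) ≡ frameRho (Z ⟨ G ⟩) (Y ⟨ G ⟩)
  ∑≡frame = trans (∑-frame _ uG (λ i i∉G → binary-ρ (Z-off i i∉G) (bY i i∉G)))
                  (cong sum (map-pair (λ z c → ρ (z - c)) Z Y G))

Settled : List (List ℤ) → List (List ℤ) → List ℤ → Set
Settled refs survivors cs = Any (Clash cs) refs ⊎ cs ∈ survivors

settled? : ∀ refs survivors → Decidable (Settled refs survivors)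
settled? refs survivors cs = any? (clash? cs) refs ⊎-dec (cs ∈? survivors)
  where open DecMembership (ListP.≡-dec ℤ._≟_) using (_∈?_)

verify : ∀ refs survivors zs → {_ : True (All.all? (settled? refs survivors) (candidates zs))} →
  All (Settled refs survivors) (candidates zs)
verify refs survivors zs {ok} = toWitness ok

record Landmark {n} (T : Point n → Set) (F : List (Fin n)) : Set where
  constructor landmark
  field
    point    : Point n
    codeword : T point
    binary   : Binary F point
    profile  : List ℤ
    profile≡ : point ⟨ F ⟩ ≡ profile

open Landmark

survey : ∀ {n} {T : Point n → Set} {F : List (Fin n)} {zs survivors} → IsTiling n T → Unique F →
  (Z C : Point n) → Z ⟨ F ⟩ ≡ zs → T C → ∑ (ρ ∘ (Z ⊖ C)) ≤ 1 → Binary F C →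
  (Ls : List (Landmark T F)) → All (Settled (map profile Ls) survivors) (candidates zs) →
  C ⟨ F ⟩ ∈ survivors
survey {F = F} til uF Z C refl TC ∑≤1 bC Ls table
  with All.lookup table (profile-candidate Z C uF ∑≤1)
... | inj₂ survives = survives
... | inj₁ clash = ⊥-elim (refute Ls clash)
  where
  refute : (Ls : List (Landmark _ F)) → ¬ Any (Clash (C ⟨ F ⟩)) (map profile Ls)
  refute (L ∷ Ls) (here c) =
    no-clash til uF TC (codeword L) bC (binary L) (subst (Clash (C ⟨ F ⟩)) (sym (profile≡ L)) c)
  refute (L ∷ Ls) (there c) = refute Ls c

isTwo : ℤ → ℕ
isTwo x = if does (x ℤ.≟ + 2) then 1 else 0

count2-∑ : ∀ {n} (Y : Point n) → count2 Y ≡ ∑ (isTwo ∘ Y)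
count2-∑ {zero} Y = refl
count2-∑ {suc n} Y with Y zero ℤ.≟ + 2
... | yes _ = cong suc (count2-∑ (Y ∘ suc))
... | no _ = count2-∑ (Y ∘ suc)

binary-isTwo : ∀ {x} → x ≡ + 0 ⊎ x ≡ + 1 → isTwo x ≡ 0
binary-isTwo (inj₁ refl) = refl
binary-isTwo (inj₂ refl) = refl

count-frame : ∀ {n} {G : List (Fin n)} (Y : Point n) → Unique G → Binary G Y →
  count2 Y ≡ sum (map isTwo (Y ⟨ G ⟩))
count-frame {G = G} Y uG bY = begin
  count2 Y                    ≡⟨ count2-∑ Y ⟩
  ∑ (isTwo ∘ Y)               ≡⟨ ∑-frame (isTwo ∘ Y) uG (λ i i∉G → binary-isTwo (bY i i∉G)) ⟩
  sum (map (isTwo ∘ Y) G)     ≡⟨ cong sum (ListP.map-∘ G) ⟩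
  sum (map isTwo (Y ⟨ G ⟩))   ∎
  where open ≡-Reasoning

twos-≤-count : ∀ {n} {G : List (Fin n)} (Y : Point n) → Unique G → All (λ i → Y i ≡ + 2) G →
  length G ≤ count2 Y
twos-≤-count {G = G} Y uG twos =
  subst (_≤ count2 Y) (frame-twos twos)
        (subst (sum (map (isTwo ∘ Y) G) ≤_) (sym (count2-∑ Y)) (frame-≤-∑ (isTwo ∘ Y) uG))
  where
  frame-twos : ∀ {G} → All (λ i → Y i ≡ + 2) G → sum (map (isTwo ∘ Y) G) ≡ length G
  frame-twos [] = refl
  frame-twos (Yi≡2 ∷ twos) rewrite Yi≡2 = cong suc (frame-twos twos)

indicator : ∀ {n} → List (Fin n) → Point n
indicator F i = if does (any? (i FinP.≟_) F) then + 1 else + 0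

indicator-∈ : ∀ {n} (F : List (Fin n)) i → i ∈ F → indicator F i ≡ + 1
indicator-∈ F i i∈F with any? (i FinP.≟_) F
... | yes _ = refl
... | no i∉F = ⊥-elim (i∉F i∈F)

indicator-∉ : ∀ {n} (F : List (Fin n)) i → i ∉ F → indicator F i ≡ + 0
indicator-∉ F i i∉F with any? (i FinP.≟_) F
... | yes i∈F = ⊥-elim (i∉F i∈F)
... | no _ = refl

e-same : ∀ {n} (a : Fin n) → e a a ≡ + 1
e-same a with a FinP.≟ a
... | yes _ = refl
... | no a≢a = ⊥-elim (a≢a refl)

e-other : ∀ {n} (a : Fin n) {i} → i ≢ a → e a i ≡ + 0
e-other a {i} i≢a with a FinP.≟ i
... | yes a≡i = ⊥-elim (i≢a (sym a≡i))
... | no _ = refl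

extend-unique : ∀ {n} {m : Fin n} {F} → m ∉ F → Unique F → Unique (m ∷ F)
extend-unique m∉F uF = ¬Any⇒All¬ _ m∉F ∷ uF

values₄ : ∀ {A : Set} {a b c d w x y z : A} →
  _≡_ {A = List A} (a ∷ b ∷ c ∷ d ∷ []) (w ∷ x ∷ y ∷ z ∷ []) → a ≡ w × b ≡ x × c ≡ y × d ≡ z
values₄ refl = refl , refl , refl , refl

head-tail : ∀ {A : Set} {a w : A} {as ws : List A} → _≡_ {A = List A} (a ∷ as) (w ∷ ws) → a ≡ w × as ≡ ws
head-tail refl = refl , refl

-- Profiles on the frame (r, s, k), possibly preceded by a further coordinate m.
Zero₃ Zero₄ X₃ X₄ Bad₃ Good₄ : List ℤ
Zero₃ = + 0 ∷ + 0 ∷ + 0 ∷ []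
Zero₄ = + 0 ∷ Zero₃
X₃ = + 3 ∷ + 2 ∷ + 0 ∷ []
X₄ = + 0 ∷ X₃
Bad₃ = + 1 ∷ + 2 ∷ + 3 ∷ []
Good₄ = + 2 ∷ + 1 ∷ + 2 ∷ + 2 ∷ []

-- Covering e_r + e_s + e_k: against 0 and X only the good and the bad profile survive.
Z-table₃ : All (Settled (Zero₃ ∷ X₃ ∷ []) (Bad₃ ∷ [])) (candidates (+ 1 ∷ + 1 ∷ + 1 ∷ []))
Z-table₃ = verify _ _ (+ 1 ∷ + 1 ∷ + 1 ∷ [])

Z-table₄ : All (Settled (Zero₄ ∷ X₄ ∷ []) (Good₄ ∷ (+ 0 ∷ Bad₃) ∷ (+ 1 ∷ Bad₃) ∷ []))
               (candidates (+ 0 ∷ + 1 ∷ + 1 ∷ + 1 ∷ []))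
Z-table₄ = verify _ _ (+ 0 ∷ + 1 ∷ + 1 ∷ + 1 ∷ [])

-- Covering e_r + e_k: against 0, X and a codeword of bad profile nothing survives.
P-table₃ : All (Settled (Zero₃ ∷ X₃ ∷ Bad₃ ∷ []) []) (candidates (+ 1 ∷ + 0 ∷ + 1 ∷ []))
P-table₃ = verify _ _ (+ 1 ∷ + 0 ∷ + 1 ∷ [])

P-table₄ : ∀ {c} → c ≡ + 0 ⊎ c ≡ + 1 →
  All (Settled (Zero₄ ∷ X₄ ∷ (c ∷ Bad₃) ∷ []) []) (candidates (+ 0 ∷ + 1 ∷ + 0 ∷ + 1 ∷ []))
P-table₄ (inj₁ refl) = verify _ _ (+ 0 ∷ + 1 ∷ + 0 ∷ + 1 ∷ [])
P-table₄ (inj₂ refl) = verify _ _ (+ 0 ∷ + 1 ∷ + 0 ∷ + 1 ∷ [])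

module Configuration {n} {T : Point n → Set} (til : IsTiling n T) (T𝟎 : T 𝟎)
  {r s : Fin n} (r≢s : r ≢ s) (TX : T (((+ 3) · (e r)) ⊕ ((+ 2) · (e s))))
  {k : Fin n} (k≢r : k ≢ r) (k≢s : k ≢ s) where

  rsk : List (Fin n)
  rsk = r ∷ s ∷ k ∷ []

  unique-rsk : Unique rsk
  unique-rsk = (r≢s ∷ (k≢r ∘ sym) ∷ []) ∷ ((k≢s ∘ sym) ∷ []) ∷ [] ∷ []

  outside-rsk : ∀ {i} → i ∉ rsk → i ≢ r × i ≢ s × i ≢ k
  outside-rsk i∉ = i∉ ∘ here , i∉ ∘ there ∘ here , i∉ ∘ there ∘ there ∘ here

  apart-from-rsk : ∀ {i} → i ≢ r → i ≢ s → i ≢ k → i ∉ rsk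
  apart-from-rsk i≢r i≢s i≢k (here i≡r) = i≢r i≡r
  apart-from-rsk i≢r i≢s i≢k (there (here i≡s)) = i≢s i≡s
  apart-from-rsk i≢r i≢s i≢k (there (there (here i≡k))) = i≢k i≡k

  X Z P : Point n
  X = ((+ 3) · (e r)) ⊕ ((+ 2) · (e s))
  Z = indicator rsk
  P = indicator (r ∷ k ∷ [])

  X-off : ∀ {i} → i ≢ r → i ≢ s → X i ≡ + 0
  X-off {i} i≢r i≢s rewrite e-other r i≢r | e-other s i≢s = refl

  X-profile : X ⟨ rsk ⟩ ≡ X₃
  X-profile rewrite e-same r | e-other s r≢s | e-other r (r≢s ∘ sym) | e-same s | X-off k≢r k≢s = refl

  X-binary : Binary rsk X
  X-binary i i∉ = let (i≢r , i≢s , _) = outside-rsk i∉ in inj₁ (X-off i≢r i≢s)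

  Z-off : ∀ i → i ∉ rsk → Z i ≡ + 0
  Z-off = indicator-∉ rsk

  Z-profile : Z ⟨ rsk ⟩ ≡ + 1 ∷ + 1 ∷ + 1 ∷ []
  Z-profile = cong₂ _∷_ (indicator-∈ rsk r (here refl)) (cong₂ _∷_ (indicator-∈ rsk s (there (here refl)))
                (cong₂ _∷_ (indicator-∈ rsk k (there (there (here refl)))) refl))

  P-off : ∀ i → i ∉ rsk → P i ≡ + 0
  P-off i i∉ = indicator-∉ (r ∷ k ∷ []) i λ { (here i≡r) → i∉ (here i≡r)
                                             ; (there (here i≡k)) → i∉ (there (there (here i≡k))) }

  P-profile : P ⟨ rsk ⟩ ≡ + 1 ∷ + 0 ∷ + 1 ∷ []
  P-profile = cong₂ _∷_ (indicator-∈ (r ∷ k ∷ []) r (here refl)) (cong₂ _∷_ (indicator-∉ (r ∷ k ∷ []) s s∉rk)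
                (cong₂ _∷_ (indicator-∈ (r ∷ k ∷ []) k (there (here refl))) refl))
    where s∉rk : s ∉ r ∷ k ∷ []
          s∉rk (here s≡r) = r≢s (sym s≡r)
          s∉rk (there (here s≡k)) = k≢s (sym s≡k)

  origin : ∀ G → Landmark T G
  origin G = landmark 𝟎 T𝟎 (λ _ _ → inj₁ refl) (map (λ _ → + 0) G) refl

  X-landmark : Landmark T rsk
  X-landmark = landmark X TX X-binary X₃ X-profile

  X-landmark⁺ : ∀ {m} → m ∉ rsk → Landmark T (m ∷ rsk)
  X-landmark⁺ m∉ = let (m≢r , m≢s , _) = outside-rsk m∉ in
    landmark X TX (binary-extend X-binary) X₄ (cong₂ _∷_ (X-off m≢r m≢s) X-profile)

  Bad : Point n → Set
  Bad C = C ⟨ rsk ⟩ ≡ Bad₃ × Binary rsk C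

  Good : Point n → Set
  Good C = Σ[ j ∈ Fin n ] j ∉ rsk × C ⟨ j ∷ rsk ⟩ ≡ Good₄ × Binary (j ∷ rsk) C

  classify : ∀ {C} → T C → Υ n (Z ⊖ C) → Good C ⊎ Bad C
  classify {C} TC ΥC with over-shape Z C unique-rsk Z-off (Υ-elim _ ΥC)
  ... | inj₁ bC with survey til unique-rsk Z C Z-profile TC (Υ-elim _ ΥC) bC
                       (origin rsk ∷ X-landmark ∷ []) Z-table₃
  ...   | here C-profile = inj₂ (C-profile , bC)
  ...   | there ()
  classify {C} TC ΥC | inj₂ (m , m∉ , bC)
    with survey til (extend-unique m∉ unique-rsk) Z C (cong₂ _∷_ (Z-off m m∉) Z-profile) TC (Υ-elim _ ΥC) bC
                (origin (m ∷ rsk) ∷ X-landmark⁺ m∉ ∷ []) Z-table₄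
  ... | here C-profile = inj₁ (m , m∉ , C-profile , bC)
  ... | there (here C-profile) =
    let (Cm , C-profile′) = head-tail C-profile in inj₂ (C-profile′ , binary-shrink bC (inj₁ Cm))
  ... | there (there (here C-profile)) =
    let (Cm , C-profile′) = head-tail C-profile in inj₂ (C-profile′ , binary-shrink bC (inj₂ Cm))
  ... | there (there (there ()))

  -- A codeword of bad shape leaves no codeword to cover P = e_r + e_k.
  no-bad : ∀ {C} → T C → ¬ Bad C
  no-bad {C} TC (C-profile , bC) with proj₁ til P
  ... | D , TD , ΥD with over-shape P D unique-rsk P-off (Υ-elim _ ΥD)
  ...   | inj₁ bD with survey til unique-rsk P D P-profile TD (Υ-elim _ ΥD) bD
                      (origin rsk ∷ X-landmark ∷ landmark C TC bC Bad₃ C-profile ∷ []) P-table₃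
  ...     | ()
  no-bad {C} TC (C-profile , bC) | D , TD , ΥD | inj₂ (m , m∉ , bD)
    with survey til (extend-unique m∉ unique-rsk) P D (cong₂ _∷_ (P-off m m∉) P-profile) TD (Υ-elim _ ΥD) bD
           (origin (m ∷ rsk) ∷ X-landmark⁺ m∉
             ∷ landmark C TC (binary-extend bC) (C m ∷ Bad₃) (cong (C m ∷_) C-profile) ∷ [])
           (P-table₄ (bC m m∉))
  ... | ()

  Witness : Fin n → Set
  Witness j = Σ (Point n) (λ Y → T Y × D₃ n Y × Y r ≡ + 1 × Y s ≡ + 2 × Y k ≡ + 2 × Y j ≡ + 2)

  in-Good₄ : ∀ {x} → x ∈ Good₄ → x ≡ + 1 ⊎ x ≡ + 2
  in-Good₄ (here x≡2) = inj₂ x≡2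
  in-Good₄ (there (here x≡1)) = inj₁ x≡1
  in-Good₄ (there (there (here x≡2))) = inj₂ x≡2
  in-Good₄ (there (there (there (here x≡2)))) = inj₂ x≡2

  good-witness : ∀ {C} → T C → (good : Good C) → Witness (proj₁ good)
  good-witness {C} TC (j , j∉ , C-profile , bC) =
    let (Cj , Cr , Cs , Ck) = values₄ C-profile in C , TC , (ternary , count) , Cr , Cs , Ck , Cj
    where
    ternary : ∀ i → C i ≡ + 0 ⊎ C i ≡ + 1 ⊎ C i ≡ + 2
    ternary i with frame-or-binary C bC i
    ... | inj₁ Ci∈ = inj₂ (in-Good₄ (subst (C i ∈_) C-profile Ci∈))
    ... | inj₂ (inj₁ Ci≡0) = inj₁ Ci≡0
    ... | inj₂ (inj₂ Ci≡1) = inj₂ (inj₁ Ci≡1)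
    count : count2 C ≡ 3
    count = trans (count-frame C (extend-unique j∉ unique-rsk) bC) (cong (sum ∘ map isTwo) C-profile)

  -- Every witness covers Z: its fourth two is the only coordinate off the cube.
  witness-over-Z : ∀ {j} → j ∉ rsk → ((Y , _) : Witness j) → Υ n (Z ⊖ Y)
  witness-over-Z {j} j∉ (Y , TY , (ternary , count) , Yr , Ys , Yk , Yj) =
    over-from-profile Z Y (extend-unique j∉ unique-rsk) (λ i i∉ → Z-off i (i∉ ∘ there)) bY
      (subst₂ (λ a b → frameRho a b ≤ 1) (sym Z-profile⁺) (sym Y-profile) ℕP.≤-refl)
    where
    Z-profile⁺ : Z ⟨ j ∷ rsk ⟩ ≡ + 0 ∷ + 1 ∷ + 1 ∷ + 1 ∷ []
    Z-profile⁺ = cong₂ _∷_ (Z-off j j∉) Z-profile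
    Y-profile : Y ⟨ j ∷ rsk ⟩ ≡ Good₄
    Y-profile = cong₂ _∷_ Yj (cong₂ _∷_ Yr (cong₂ _∷_ Ys (cong₂ _∷_ Yk refl)))
    -- a further two would make four of them
    bY : Binary (j ∷ rsk) Y
    bY i i∉ with ternary i
    ... | inj₁ Yi≡0 = inj₁ Yi≡0
    ... | inj₂ (inj₁ Yi≡1) = inj₂ Yi≡1
    ... | inj₂ (inj₂ Yi≡2) =
      ⊥-elim (4≰3 (subst (4 ≤_) count (twos-≤-count Y twos-unique (Yi≡2 ∷ Yj ∷ Ys ∷ Yk ∷ []))))
      where twos-unique : Unique (i ∷ j ∷ s ∷ k ∷ [])
            twos-unique = (i∉ ∘ here ∷ i∉ ∘ there ∘ there ∘ here ∷ i∉ ∘ there ∘ there ∘ there ∘ here ∷ [])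
                        ∷ (j∉ ∘ there ∘ here ∷ j∉ ∘ there ∘ there ∘ here ∷ [])
                        ∷ ((k≢s ∘ sym) ∷ []) ∷ [] ∷ []
            4≰3 : ¬ 4 ≤ 3
            4≰3 (s≤s (s≤s (s≤s ())))

  -- A witness covers Z like C, so it is C, whose twos sit on s, k and j only.
  witness-unique : ∀ {C} → T C → Υ n (Z ⊖ C) → (good : Good C) →
    ∀ {j′} → j′ ∉ rsk → Witness j′ → j′ ≡ proj₁ good
  witness-unique {C} TC ΥC (j , j∉ , C-profile , bC) {j′} j′∉ w@(Y , TY , _ , _ , _ , _ , Yj′)
    with j′ FinP.≟ j
  ... | yes j′≡j = j′≡j
  ... | no j′≢j = ⊥-elim (two-not-binary (bC j′ λ { (here j′≡j) → j′≢j j′≡j ; (there j′∈) → j′∉ j′∈ }))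
    where
    Cj′≡2 : C j′ ≡ + 2
    Cj′≡2 = trans (proj₂ til Z C Y TC TY ΥC (witness-over-Z j′∉ w) j′) Yj′
    two-not-binary : ¬ (C j′ ≡ + 0 ⊎ C j′ ≡ + 1)
    two-not-binary (inj₁ Cj′≡0) with trans (sym Cj′≡0) Cj′≡2
    ... | ()
    two-not-binary (inj₂ Cj′≡1) with trans (sym Cj′≡1) Cj′≡2
    ... | ()

  unique-fourth-two : Σ (Fin n) λ j → ((j ≢ r × j ≢ s × j ≢ k) × Witness j) ×
              ((j′ : Fin n) → j′ ≢ r → j′ ≢ s → j′ ≢ k → Witness j′ → j′ ≡ j)
  unique-fourth-two with proj₁ til Z
  ... | C , TC , ΥC with classify TC ΥC
  ...   | inj₂ bad = ⊥-elim (no-bad TC bad)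
  ...   | inj₁ good@(j , j∉ , _) =
    j , (outside-rsk j∉ , good-witness TC good) ,
    λ j′ j′≢r j′≢s j′≢k → witness-unique TC ΥC good (apart-from-rsk j′≢r j′≢s j′≢k)

lemma12 : (n : ℕ) (T : Point n → Set) → IsTiling n T → T 𝟎 →
    (r s : Fin n) → r ≢ s → T (((+ 3) · (e r)) ⊕ ((+ 2) · (e s))) →
    (k : Fin n) → k ≢ r → k ≢ s →
    Σ (Fin n) λ j → ((j ≢ r × j ≢ s × j ≢ k) ×
      Σ (Point n) (λ Y → T Y × D₃ n Y × Y r ≡ + 1 × Y s ≡ + 2 × Y k ≡ + 2 × Y j ≡ + 2)) ×
      ((j' : Fin n) → j' ≢ r → j' ≢ s → j' ≢ k →
        Σ (Point n) (λ Y → T Y × D₃ n Y × Y r ≡ + 1 × Y s ≡ + 2 × Y k ≡ + 2 × Y j' ≡ + 2) →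
        j' ≡ j)
lemma12 n T til T𝟎 r s r≢s TX k k≢r k≢s = Configuration.unique-fourth-two til T𝟎 r≢s TX k≢r k≢s
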